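{- For all natural numbers $m, n$ and every integer $d \geq 2$ there exists $h_0 \in \mathbb{N}$ such that for every $h \geq h_0$ the double-tree of degree $d$ and height $h$ has at least $m$ leaves whose pairwise graph distances (in the double-tree) are all at least $n$.
   Context: The double-tree of degree $d$ and height $h$ is the following graph. Take two disjoint complete rooted $d$-ary trees of height $h$ (every inner vertex has exactly $d$ children and all leaves are at depth $h$), called the upper and the lower tree, each drawn in the plane with children ordered left to right. Let $l = d^{h-1}$ be the number of parents of leaves in each tree. Name the leaves of the upper tree from left to right $u_1^1,\ldots,u_d^1,u_1^2,\ldots,u_d^2,\ldots,u_1^l,\ldots,u_d^l$ (so $u_1^j,\ldots,u_d^j$ are the children of the $j$-th parent of leaves), and likewise the leaves of the lower tree $v_1^1,\ldots,v_d^l$. Besides the tree edges, add $E_1 = \{u_i^j u_{i+1}^j, \ v_i^j v_{i+1}^j : 1\le i\le d-1,\ 1\le j\le l\} \cup \{u_d^j u_1^{j+1},\ v_d^j v_1^{j+1} : 1\le j\le l-1\}$ and $E_2 = \{u_n^j v_m^j : 1\le j\le l,\ n\le m\} \cup \{u_n^j v_m^{j+1} : 1\le j\le l-1,\ m<n\} \cup \{u_n^l v_m^1 : m<n\}$, where $1\le n,m\le d$. The leaves of the double-tree are the vertices $u_i^j$ and $v_i^j$. -}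

module Defs where

open import Data.Nat using (ℕ; zero; suc; _+_; _*_; _∸_; _^_; _≤_; _<_)
open import Data.Product using (_×_; _,_)

data Side : Set where
  upper lower : Side

-- A vertex of the double-tree of degree d and height h is (s , k , a):
-- the a-th vertex (0-indexed, left to right) at depth k of tree s,
-- where k ≤ h and a < d ^ k.  (Only such triples occur as edge endpoints.)
-- The children of (s , k , a) are (s , k+1 , a * d + c) for c < d.  With l = d ^ (h ∸ 1), the leaf
-- u_i^j (1-indexed i, j) is (upper , h , (j-1) * d + (i-1)), and likewise v_i^j.
Vertex : Set
Vertex = Side × ℕ × ℕ

parents : ℕ → ℕ → ℕ
parents d h = d ^ (h ∸ 1)

-- Edges of the double-tree (one orientation); indices j, i, n, m are 0-indexed.
data Edge (d h : ℕ) : Vertex → Vertex → Set where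
  tree   : ∀ s k a c → k < h → a < d ^ k → c < d →
           Edge d h (s , k , a) (s , suc k , a * d + c)
  -- E1: u_i^j u_{i+1}^j and v_i^j v_{i+1}^j
  e1-in  : ∀ s j i → j < parents d h → suc i < d →
           Edge d h (s , h , j * d + i) (s , h , j * d + suc i)
  -- E1: u_d^j u_1^{j+1} and v_d^j v_1^{j+1}
  e1-out : ∀ s j → suc j < parents d h →
           Edge d h (s , h , j * d + (d ∸ 1)) (s , h , suc j * d + 0)
  -- E2: u_n^j v_m^j with n ≤ m
  e2-same : ∀ j n m → j < parents d h → n ≤ m → m < d →
            Edge d h (upper , h , j * d + n) (lower , h , j * d + m)
  -- E2: u_n^j v_m^{j+1} with m < n
  e2-next : ∀ j n m → suc j < parents d h → m < n → n < d →
            Edge d h (upper , h , j * d + n) (lower , h , suc j * d + m)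
  -- E2: u_n^l v_m^1 with m < n
  e2-wrap : ∀ n m → m < n → n < d →
            Edge d h (upper , h , (parents d h ∸ 1) * d + n) (lower , h , 0 * d + m)

data Adj (d h : ℕ) (x y : Vertex) : Set where
  fwd : Edge d h x y → Adj d h x y
  bwd : Edge d h y x → Adj d h x y

data Walk (d h : ℕ) : Vertex → Vertex → ℕ → Set where
  here : ∀ {x} → Walk d h x x 0
  step : ∀ {x y z k} → Adj d h x y → Walk d h y z k → Walk d h x z (suc k)

-- graph distance between x and y is at least n
-- (every walk from x to y has length ≥ n; dist = ∞ if disconnected)
DistAtLeast : (d h : ℕ) → Vertex → Vertex → ℕ → Set
DistAtLeast d h x y n = ∀ k → Walk d h x y k → n ≤ k

IsLeaf : (d h : ℕ) → Vertex → Set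
IsLeaf d h (s , k , a) = (k ≡ h) × (a < d ^ h)
  where open import Relation.Binary.PropositionalEquality using (_≡_)

module Submission where

-- Give every vertex v at depth k with index a the position
--   pos v = a * d ^ (h ∸ k),
-- the index of the leftmost leaf below v, and call h ∸ k its gap (height
-- above the leaves).  Every edge changes the gap by at most one, and every
-- edge whose upper end has gap ≤ n moves the position by at most
--   jump d n = d ^ n + (d + d),
-- except for the E2 wrap-around edges, which join a leaf within d of the
-- right end of the leaf row to a leaf within d of its left end
-- (edge-jump).  Hence a walk of length k ≤ n ending at a leaf b at distance
-- more than n * jump d n from both ends never uses a wrap-around edge and
-- starts within k * jump d n of b (walk-confined), so leaves whose positions
-- differ by more than n * jump d n are at graph distance ≥ n (far-leaves).
-- Finally m leaves placed at spacing suc (n * jump d n + d) are pairwise far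
-- and fit into the row once suc m * spacing < d ^ h (spaced-leaves), which
-- holds for every h ≥ suc m * spacing because h < d ^ h when d ≥ 2.

open import Defs
open import Data.Nat using (ℕ; _≤_)
open import Data.Fin using (Fin)
open import Data.Product using (Σ; ∃-syntax; _×_)
open import Relation.Binary.PropositionalEquality using (_≡_; _≢_)

open import Data.Nat
  using (zero; suc; _+_; _*_; _∸_; _^_; _<_; z≤n; s≤s; _≤?_; ∣_-_∣; NonZero; ≢-nonZero; >-nonZero; >-nonZero⁻¹)
open import Data.Nat.Properties
open import Data.Fin using (toℕ)
open import Data.Fin.Properties using (toℕ-injective; toℕ<n)
open import Data.Product using (_,_; proj₁; proj₂)
open import Data.Sum using (_⊎_; inj₁; inj₂)
open import Data.Empty using (⊥-elim)
open import Relation.Nullary using (yes; no)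
open import Relation.Binary.PropositionalEquality using (refl; sym; trans; cong; subst)

n<m^n : ∀ m → 1 < m → ∀ n → n < m ^ n
n<m^n m 1<m zero    = s≤s z≤n
n<m^n m 1<m (suc n) = ≤-<-trans (n<m^n m 1<m n) (^-monoʳ-< m 1<m (n<1+n n))

spaced-apart : ∀ S {m} (i j : Fin m) → i ≢ j →
               S ≤ ∣ suc (toℕ i) * S - suc (toℕ j) * S ∣
spaced-apart S i j i≢j =
  subst (S ≤_) (*-distribʳ-∣-∣ S (suc (toℕ i)) (suc (toℕ j)))
    (m≤n*m S _ {{≢-nonZero distinct}})
  where
  distinct : ∣ suc (toℕ i) - suc (toℕ j) ∣ ≢ 0
  distinct eq = i≢j (toℕ-injective (suc-injective (∣m-n∣≡0⇒m≡n eq)))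

-- The largest position change along an edge of the double-tree of degree d
-- whose upper end has gap ≤ n (one tree edge, or two nearby leaf blocks).
jump : ℕ → ℕ → ℕ
jump d n = d ^ n + (d + d)

-- Spacing of the chosen leaves: more than n * jump d n plus the end margin d.
spacing : ℕ → ℕ → ℕ
spacing d n = suc (n * jump d n + d)

module Positions (d : ℕ) .{{_ : NonZero d}} (h : ℕ) where

  gap : Vertex → ℕ
  gap (_ , k , _) = h ∸ k

  -- Index of the leftmost leaf below a vertex.
  pos : Vertex → ℕ
  pos (_ , k , a) = a * d ^ (h ∸ k)

  pos-leaf : ∀ s a → pos (s , h , a) ≡ a
  pos-leaf s a rewrite n∸n≡0 h = *-identityʳ a

  edge-gap : ∀ {p q} → Edge d h p q → gap p ≡ suc (gap q) ⊎ gap p ≡ gap q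
  edge-gap (tree _ k _ _ k<h _ _) = inj₁ (+-∸-assoc 1 k<h)
  edge-gap (e1-in _ _ _ _ _)      = inj₂ refl
  edge-gap (e1-out _ _ _)         = inj₂ refl
  edge-gap (e2-same _ _ _ _ _ _)  = inj₂ refl
  edge-gap (e2-next _ _ _ _ _ _)  = inj₂ refl
  edge-gap (e2-wrap _ _ _ _)      = inj₂ refl

  adj-gap : ∀ {p q} → Adj d h p q → gap p ≤ suc (gap q)
  adj-gap (fwd e) with edge-gap e
  ... | inj₁ eq = ≤-reflexive eq
  ... | inj₂ eq = ≤-trans (≤-reflexive eq) (n≤1+n _)
  adj-gap (bwd e) with edge-gap e
  ... | inj₁ eq = m≤n⇒m≤1+n (≤-trans (n≤1+n _) (≤-reflexive (sym eq)))
  ... | inj₂ eq = ≤-trans (≤-reflexive (sym eq)) (n≤1+n _)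

  tree-jump : ∀ a c t → c < d → ∣ a * d ^ suc t - (a * d + c) * d ^ t ∣ < d ^ suc t
  tree-jump a c t c<d = begin-strict
    ∣ a * d ^ suc t - (a * d + c) * d ^ t ∣          ≡⟨ cong (λ x → ∣ a * d ^ suc t - x ∣) split ⟩
    ∣ a * d ^ suc t - a * d ^ suc t + c * d ^ t ∣    ≡⟨ ∣m-m+n∣≡n (a * d ^ suc t) (c * d ^ t) ⟩
    c * d ^ t                                        <⟨ *-monoˡ-< (d ^ t) {{m^n≢0 d t}} c<d ⟩
    d ^ suc t                                        ∎
    where
    open ≤-Reasoning
    split : (a * d + c) * d ^ t ≡ a * d ^ suc t + c * d ^ t
    split = trans (*-distribʳ-+ (d ^ t) (a * d) c) (cong (_+ c * d ^ t) (*-assoc a d (d ^ t)))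

  block-jump : ∀ J x y → x < d + d → y < d + d → ∣ J + x - J + y ∣ < d + d
  block-jump J x y x<2d y<2d rewrite ∣m+n-m+o∣≡∣n-o∣ J x y =
    ≤-<-trans (∣m-n∣≤m⊔n x y) (⊔-lub x<2d y<2d)

  next-block : ∀ j y → suc j * d + y ≡ j * d + (d + y)
  next-block j y = trans (cong (_+ y) (+-comm d (j * d))) (+-assoc (j * d) d y)

  -- Hence every E1 edge and every non-wrapping E2 edge is short.
  leaf-edge-jump : ∀ n s t J x y → x < d + d → y < d + d →
                   ∣ pos (s , h , J + x) - pos (t , h , J + y) ∣ ≤ jump d n
  leaf-edge-jump n s t J x y x<2d y<2d rewrite pos-leaf s (J + x) | pos-leaf t (J + y) =
    ≤-trans (<⇒≤ (block-jump J x y x<2d y<2d)) (m≤n+m (d + d) (d ^ n))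

  WrapsAround : Vertex → Vertex → Set
  WrapsAround p q = (d ^ h ≤ pos p + d) × (pos q < d)

  -- The last block of d leaves reaches the end d ^ h of the leaf row, so the
  -- upper end of a wrap-around edge lies within d of that end.
  last-block : ∀ x → d ^ h ≤ (parents d h ∸ 1) * d + x + d
  last-block x = begin
    d ^ h                           ≤⟨ ^-monoʳ-≤ d (m≤n+m∸n h 1) ⟩
    d * P                           ≡⟨ *-comm d P ⟩
    P * d                           ≡⟨ cong (_* d) (m+[n∸m]≡n (m^n>0 d (h ∸ 1))) ⟨
    d + (P ∸ 1) * d                 ≡⟨ +-comm d ((P ∸ 1) * d) ⟩
    (P ∸ 1) * d + d                 ≤⟨ +-monoˡ-≤ d (m≤m+n ((P ∸ 1) * d) x) ⟩
    (P ∸ 1) * d + x + d             ∎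
    where
    open ≤-Reasoning
    P : ℕ
    P = parents d h

  below2d : ∀ {x} → x < d → x < d + d
  below2d x<d = ≤-trans x<d (m≤m+n d d)

  edge-jump : ∀ n {p q} → Edge d h p q → gap p ≤ n → ∣ pos p - pos q ∣ ≤ jump d n ⊎ WrapsAround p q
  edge-jump n (tree s k a c k<h _ c<d) gp rewrite +-∸-assoc 1 k<h =
    inj₁ (≤-trans (<⇒≤ (tree-jump a c (h ∸ suc k) c<d))
                  (≤-trans (^-monoʳ-≤ d gp) (m≤m+n (d ^ n) (d + d))))
  edge-jump n (e1-in s j i _ si<d) _ =
    inj₁ (leaf-edge-jump n s s (j * d) i (suc i) (below2d (<-trans (n<1+n i) si<d)) (below2d si<d))
  edge-jump n (e1-out s j _) _ rewrite next-block j 0 =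
    inj₁ (leaf-edge-jump n s s (j * d) (d ∸ 1) (d + 0)
            (≤-<-trans (m∸n≤m d 1) (m<m+n d (>-nonZero⁻¹ d)))
            (+-monoʳ-< d (>-nonZero⁻¹ d)))
  edge-jump n (e2-same j x y _ x≤y y<d) _ =
    inj₁ (leaf-edge-jump n upper lower (j * d) x y (below2d (≤-<-trans x≤y y<d)) (below2d y<d))
  edge-jump n (e2-next j x y _ y<x x<d) _ rewrite next-block j y =
    inj₁ (leaf-edge-jump n upper lower (j * d) x (d + y) (below2d x<d) (+-monoʳ-< d (<-trans y<x x<d)))
  edge-jump n (e2-wrap x y y<x x<d) _
    rewrite pos-leaf upper ((parents d h ∸ 1) * d + x) | pos-leaf lower y =
    inj₂ (last-block x , <-trans y<x x<d)

  Safe : ℕ → Set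
  Safe a = (d ≤ a) × (a + d < d ^ h)

  adj-jump : ∀ n {p q} → Adj d h p q → gap p ≤ n → gap q ≤ n → Safe (pos q) →
             ∣ pos p - pos q ∣ ≤ jump d n
  adj-jump n (fwd e) gp _ (d≤q , _) with edge-jump n e gp
  ... | inj₁ short       = short
  ... | inj₂ (_ , q<d)   = ⊥-elim (<⇒≱ q<d d≤q)
  adj-jump n {p} {q} (bwd e) _ gq (_ , q+d<D) with edge-jump n e gq
  ... | inj₁ short       = subst (_≤ jump d n) (∣-∣-comm (pos q) (pos p)) short
  ... | inj₂ (D≤q+d , _) = ⊥-elim (<⇒≱ q+d<D D≤q+d)

  Margin : ℕ → ℕ → Set
  Margin r a = (r + d ≤ a) × (a + r + d < d ^ h)

  margin-safe : ∀ {r a b} → Margin r a → ∣ b - a ∣ ≤ r → Safe b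
  margin-safe {r} {a} {b} (r+d≤a , a+r+d<D) b~a = d≤b , b+d<D
    where
    open ≤-Reasoning
    d≤b : d ≤ b
    d≤b = +-cancelˡ-≤ r d b (begin
      r + d           ≤⟨ r+d≤a ⟩
      a               ≤⟨ m≤∣m-n∣+n a b ⟩
      ∣ a - b ∣ + b   ≡⟨ cong (_+ b) (∣-∣-comm a b) ⟩
      ∣ b - a ∣ + b   ≤⟨ +-monoˡ-≤ b b~a ⟩
      r + b           ∎)
    b+d<D : b + d < d ^ h
    b+d<D = begin-strict
      b + d                ≤⟨ +-monoˡ-≤ d (m≤n+∣m-n∣ b a) ⟩
      a + ∣ b - a ∣ + d    ≤⟨ +-monoˡ-≤ d (+-monoʳ-≤ a b~a) ⟩
      a + r + d            <⟨ a+r+d<D ⟩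
      d ^ h                ∎

  walk-confined : ∀ n {v t a k} → Walk d h v (t , h , a) k → k ≤ n → Margin (n * jump d n) a →
                  gap v ≤ k × ∣ pos v - a ∣ ≤ k * jump d n
  walk-confined n {t = t} {a} here _ _ rewrite pos-leaf t a =
    ≤-reflexive (n∸n≡0 h) , ≤-reflexive (∣n-n∣≡0 a)
  walk-confined n {v} {a = a} {suc k} (step {y = w} adj rest) sk≤n margin =
    gap-v , ≤-trans (∣-∣-triangle (pos v) (pos w) a) (+-mono-≤ jump-vw near-w)
    where
    k≤n : k ≤ n
    k≤n = ≤-trans (n≤1+n k) sk≤n
    confined-w : gap w ≤ k × ∣ pos w - a ∣ ≤ k * jump d n
    confined-w = walk-confined n rest k≤n margin
    gap-w : gap w ≤ k
    gap-w = proj₁ confined-w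
    near-w : ∣ pos w - a ∣ ≤ k * jump d n
    near-w = proj₂ confined-w
    gap-v : gap v ≤ suc k
    gap-v = ≤-trans (adj-gap adj) (s≤s gap-w)
    jump-vw : ∣ pos v - pos w ∣ ≤ jump d n
    jump-vw = adj-jump n adj (≤-trans gap-v sk≤n) (≤-trans gap-w k≤n)
                (margin-safe margin (≤-trans near-w (*-monoˡ-≤ (jump d n) k≤n)))

  far-leaves : ∀ n s t a b → Margin (n * jump d n) b → n * jump d n < ∣ a - b ∣ →
               DistAtLeast d h (s , h , a) (t , h , b) n
  far-leaves n s t a b margin far k w with n ≤? k
  ... | yes n≤k = n≤k
  ... | no n≰k  = ⊥-elim (<⇒≱ far (begin
      ∣ a - b ∣                  ≡⟨ cong (λ x → ∣ x - b ∣) (pos-leaf s a) ⟨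
      ∣ pos (s , h , a) - b ∣    ≤⟨ proj₂ (walk-confined n w k≤n margin) ⟩
      k * jump d n                 ≤⟨ *-monoˡ-≤ (jump d n) k≤n ⟩
      n * jump d n                 ∎))
    where
    open ≤-Reasoning
    k≤n : k ≤ n
    k≤n = <⇒≤ (≰⇒> n≰k)

  spaced-margin : ∀ r m (i : Fin m) → suc m * suc (r + d) < d ^ h →
                  Margin r (suc (toℕ i) * suc (r + d))
  spaced-margin r m i fits = ≤-trans (n≤1+n (r + d)) (m≤m+n S (toℕ i * S)) , (begin-strict
    a + r + d              ≡⟨ +-assoc a r d ⟩
    a + (r + d)            <⟨ +-monoʳ-< a (n<1+n (r + d)) ⟩
    a + S                  ≡⟨ +-comm a S ⟩
    S + a                  ≤⟨ +-monoʳ-≤ S (*-monoˡ-≤ S (toℕ<n i)) ⟩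
    suc m * S              <⟨ fits ⟩
    d ^ h                  ∎)
    where
    open ≤-Reasoning
    S : ℕ
    S = suc (r + d)
    a : ℕ
    a = suc (toℕ i) * S

  spaced-leaves : ∀ m n → suc m * spacing d n < d ^ h →
    Σ (Fin m → Vertex) λ f → (((i : Fin m) → IsLeaf d h (f i))
    × ((i j : Fin m) → f i ≡ f j → i ≡ j)
    × ((i j : Fin m) → i ≢ j → DistAtLeast d h (f i) (f j) n))
  spaced-leaves m n fits = f , leaf , injective , far
    where
    r : ℕ
    r = n * jump d n
    S : ℕ
    S = spacing d n
    f : Fin m → Vertex
    f i = upper , h , suc (toℕ i) * S
    index : Vertex → ℕ
    index (_ , _ , a) = a
    leaf : ∀ i → IsLeaf d h (f i)
    leaf i = refl , ≤-<-trans (≤-trans (m≤m+n _ r) (m≤m+n _ d)) (proj₂ (spaced-margin r m i fits))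
    injective : ∀ i j → f i ≡ f j → i ≡ j
    injective i j eq = toℕ-injective (suc-injective (*-cancelʳ-≡ _ _ S (cong index eq)))
    far : ∀ i j → i ≢ j → DistAtLeast d h (f i) (f j) n
    far i j i≢j = far-leaves n upper upper _ _ (spaced-margin r m j fits)
                    (≤-trans (s≤s (m≤m+n r d)) (spaced-apart S i j i≢j))

lemma7 : (m n d : ℕ) → 2 ≤ d →
    ∃[ h₀ ] ((h : ℕ) → h₀ ≤ h →
    Σ (Fin m → Vertex) λ f → (((i : Fin m) → IsLeaf d h (f i))
    × ((i j : Fin m) → f i ≡ f j → i ≡ j)
    × ((i j : Fin m) → i ≢ j → DistAtLeast d h (f i) (f j) n)))
lemma7 m n d 2≤d = suc m * spacing d n , λ h h₀≤h →
  Positions.spaced-leaves d h m n (≤-<-trans h₀≤h (n<m^n d 2≤d h))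
  where
  instance
    d≢0 : NonZero d
    d≢0 = >-nonZero (≤-trans (s≤s z≤n) 2≤d)
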